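{- Let $R$ and $S$ be strings, let $C_{\textsc{max}}$ be a maximal cover of $S$ with respect to $R$ and let $C$ be an arbitrary cover of $S$ with respect to $R$. Then $|C_{\textsc{max}}|\le 2|C|-1$.
   Context: A cover (substring cover) of $S$ with respect to $R$ is a sequence of blocks $C=(i_1,j_1),\dots,(i_{|C|},j_{|C|})$ with $i_l\le j_l$ such that $S=R[i_1,j_1]\cdots R[i_{|C|},j_{|C|}]$. A cover is maximal if for every two consecutive blocks $(i_l,j_l),(i_{l+1},j_{l+1})$ the string $R[i_l,j_l]R[i_{l+1},j_{l+1}]$ is not a substring of $R$. -}

module Defs where

open import Data.Nat using (ℕ; suc; _≤_; _<_; _∸_)
open import Data.Product using (_×_; ∃₂; _,_)
open import Data.List using (List; []; _∷_; _++_; length; take; drop; concatMap)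
open import Data.List.Relation.Unary.All using (All)
open import Relation.Binary.PropositionalEquality using (_≡_)
open import Relation.Nullary using (¬_)
open import Data.Unit using (⊤)

-- A block (i , j) denotes positions i..j (0-indexed, inclusive).
Block : Set
Block = ℕ × ℕ

module _ {A : Set} where

  IsSubstring : List A → List A → Set
  IsSubstring x R = ∃₂ λ u v → R ≡ u ++ x ++ v

  substr : List A → Block → List A
  substr R (i , j) = take (suc j ∸ i) (drop i R)

  ValidBlock : List A → Block → Set
  ValidBlock R (i , j) = i ≤ j × j < length R

  IsCover : List A → List A → List Block → Set
  IsCover R S C = All (ValidBlock R) C × concatMap (substr R) C ≡ S

  ConsecMaximal : List A → List Block → Set
  ConsecMaximal R [] = ⊤
  ConsecMaximal R (b ∷ []) = ⊤
  ConsecMaximal R (b ∷ b' ∷ C) =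
    ¬ IsSubstring (substr R b ++ substr R b') R × ConsecMaximal R (b' ∷ C)

  IsMaximalCover : List A → List A → List Block → Set
  IsMaximalCover R S C = IsCover R S C × ConsecMaximal R C

-- A substring of R cannot contain two consecutive blocks of a maximal cover, so
-- every block of an arbitrary cover C contains the ends of at most two maximal
-- blocks, and the first one the end of at most one: 2|C| - 1 blocks in total.
-- The induction walks along the maximal blocks; whenever a maximal block runs past
-- the end of a block of C, the next maximal block starts inside a suffix of some
-- later block of C, which is again a substring of R.
module Submission where

open import Defs
open import Data.Nat using (zero; suc; _≤_; _*_; _∸_; z≤n; s≤s)
open import Data.Nat.Properties using (*-suc; *-monoʳ-≤; ≤-refl; ≤-trans; ≤-reflexive; m≤n⇒m≤1+n; n≤1+n)
open import Data.List using (List; []; _∷_; _++_; length; concat; map; take; drop)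
open import Data.List.Properties
  using (++-assoc; ++-identityʳ; ++-conicalˡ; ++-conicalʳ; ∷-injective; take++drop≡id; length-map)
open import Data.List.Relation.Unary.All using (All; []; _∷_)
open import Data.List.Relation.Unary.Linked as Linked using (Linked; []; [-]; _∷_)
open import Data.Product using (Σ-syntax; _×_; _,_)
open import Data.Sum using (_⊎_; inj₁; inj₂)
open import Relation.Nullary using (¬_; contradiction)
open import Relation.Binary.PropositionalEquality
open ≡-Reasoning

2*[1+n]∸1≡1+2*n : ∀ n → 2 * suc n ∸ 1 ≡ suc (2 * n)
2*[1+n]∸1≡1+2*n n = cong (_∸ 1) (*-suc 2 n)

3+2*m≤1+2*[1+n] : ∀ {m n} → m ≤ n → suc (suc (suc (2 * m))) ≤ suc (2 * suc n)
3+2*m≤1+2*[1+n] {m} {n} m≤n =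
  subst (suc (suc (suc (2 * m))) ≤_) (cong suc (sym (*-suc 2 n))) (s≤s (s≤s (s≤s (*-monoʳ-≤ 2 m≤n))))

module _ {A : Set} where

  ++-≡-++ : (u u′ v v′ : List A) → u ++ u′ ≡ v ++ v′ →
            (Σ[ r ∈ List A ] u ≡ v ++ r × v′ ≡ r ++ u′) ⊎
            (Σ[ q ∈ List A ] q ≢ [] × v ≡ u ++ q × u′ ≡ q ++ v′)
  ++-≡-++ u u′ [] v′ eq = inj₁ (u , refl , sym eq)
  ++-≡-++ [] u′ (y ∷ v) v′ eq = inj₂ (y ∷ v , (λ ()) , refl , eq)
  ++-≡-++ (x ∷ u) u′ (y ∷ v) v′ eq with ∷-injective eq
  ... | refl , eq′ with ++-≡-++ u u′ v v′ eq′
  ...   | inj₁ (r , u≡v++r , v′≡r++u′) = inj₁ (r , cong (x ∷_) u≡v++r , v′≡r++u′)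
  ...   | inj₂ (q , q≢[] , v≡u++q , u′≡q++v′) = inj₂ (q , q≢[] , cong (x ∷_) v≡u++q , u′≡q++v′)

module _ {A : Set} (R : List A) where

  Substring : List A → Set
  Substring w = IsSubstring w R

  Apart : List A → List A → Set
  Apart u v = ¬ Substring (u ++ v)

  []-isSubstring : Substring []
  []-isSubstring = [] , R , refl

  ++-isSubstringˡ : ∀ u v → Substring (u ++ v) → Substring u
  ++-isSubstringˡ u v (p , s , eq) = p , v ++ s , trans eq (cong (p ++_) (++-assoc u v s))

  ++-isSubstringʳ : ∀ u v → Substring (u ++ v) → Substring v
  ++-isSubstringʳ u v (p , s , eq) =
    p ++ u , s , trans eq (trans (cong (p ++_) (++-assoc u v s)) (sym (++-assoc p u (v ++ s))))

  linked-substring-length≤1 : ∀ {xs} → Linked Apart xs → Substring (concat xs) → length xs ≤ 1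
  linked-substring-length≤1 [] _ = z≤n
  linked-substring-length≤1 [-] _ = s≤s z≤n
  linked-substring-length≤1 {x ∷ x′ ∷ xs} (apart ∷ _) sub =
    contradiction (++-isSubstringˡ (x ++ x′) (concat xs)
                    (subst Substring (sym (++-assoc x x′ (concat xs))) sub))
                  apart

  resume : ∀ w rest y ys → Substring y → All Substring ys → w ++ rest ≡ y ++ concat ys →
           Σ[ q ∈ List A ] Σ[ zs ∈ List (List A) ]
             Substring q × All Substring zs × length zs ≤ length ys × rest ≡ q ++ concat zs
  resume w rest y ys y-sub ys-sub eq with ++-≡-++ w rest y (concat ys) eq
  resume w rest y [] _ _ _ | inj₁ (r , _ , []≡r++rest) =
    [] , [] , []-isSubstring , [] , z≤n , trans (++-conicalʳ r rest (sym []≡r++rest)) (sym (++-identityʳ []))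
  resume w rest y (y′ ∷ ys) _ (y′-sub ∷ ys-sub) _ | inj₁ (r , _ , y′++ys≡r++rest)
    with resume r rest y′ ys y′-sub ys-sub (sym y′++ys≡r++rest)
  ... | q , zs , q-sub , zs-sub , zs≤ys , rest≡ = q , zs , q-sub , zs-sub , m≤n⇒m≤1+n zs≤ys , rest≡
  resume w rest y ys y-sub ys-sub _ | inj₂ (q , _ , y≡w++q , rest≡q++ys) =
    q , ys , ++-isSubstringʳ w q (subst Substring y≡w++q y-sub) , ys-sub , ≤-refl , rest≡q++ys

  length-linked≤1+2*length : ∀ xs y ys → Linked Apart xs → Substring y → All Substring ys →
                             concat xs ≡ y ++ concat ys → length xs ≤ suc (2 * length ys)
  length-linked≤1+2*length xs y [] linked y-sub _ eq =
    linked-substring-length≤1 linked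
      (subst Substring (sym (trans eq (++-identityʳ y))) y-sub)
  length-linked≤1+2*length [] y (y′ ∷ ys) _ _ _ _ = z≤n
  length-linked≤1+2*length (x ∷ xs) y (y′ ∷ ys) linked y-sub (y′-sub ∷ ys-sub) eq
    with ++-≡-++ x (concat xs) y (concat (y′ ∷ ys)) eq
  ... | inj₁ (r , _ , cover≡r++xs)
    with resume r (concat xs) y′ ys y′-sub ys-sub (sym cover≡r++xs)
  ...   | q , zs , q-sub , zs-sub , zs≤ys , xs≡q++zs =
    ≤-trans (s≤s (length-linked≤1+2*length xs q zs (Linked.tail linked) q-sub zs-sub xs≡q++zs))
            (≤-trans (n≤1+n _) (3+2*m≤1+2*[1+n] zs≤ys))
  length-linked≤1+2*length (x ∷ []) y (y′ ∷ ys) _ _ _ _ | inj₂ (q , q≢[] , _ , []≡q++cover) =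
    contradiction (++-conicalˡ q _ (sym []≡q++cover)) q≢[]
  length-linked≤1+2*length (x ∷ x′ ∷ xs) y (y′ ∷ ys) (apart ∷ linked) y-sub (y′-sub ∷ ys-sub) eq
    | inj₂ (q , q≢[] , y≡x++q , x′++xs≡q++cover)
    with ++-≡-++ x′ (concat xs) q (concat (y′ ∷ ys)) x′++xs≡q++cover
  ... | inj₂ (q′ , _ , q≡x′++q′ , _) =
    contradiction (++-isSubstringˡ (x ++ x′) q′ (subst Substring y≡xx′++q′ y-sub)) apart
    where
    y≡xx′++q′ : y ≡ (x ++ x′) ++ q′
    y≡xx′++q′ = begin
      y               ≡⟨ y≡x++q ⟩
      x ++ q          ≡⟨ cong (x ++_) q≡x′++q′ ⟩
      x ++ x′ ++ q′   ≡⟨ ++-assoc x x′ q′ ⟨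
      (x ++ x′) ++ q′ ∎
  ... | inj₁ (r , _ , cover≡r++xs)
    with resume r (concat xs) y′ ys y′-sub ys-sub (sym cover≡r++xs)
  ...   | q″ , zs , q″-sub , zs-sub , zs≤ys , xs≡q″++zs =
    ≤-trans (s≤s (s≤s (length-linked≤1+2*length xs q″ zs (Linked.tail linked) q″-sub zs-sub xs≡q″++zs)))
            (3+2*m≤1+2*[1+n] zs≤ys)

  substr-isSubstring : ∀ b → Substring (substr R b)
  substr-isSubstring (i , j) =
    take i R , drop (suc j ∸ i) (drop i R) ,
    sym (trans (cong (take i R ++_) (take++drop≡id (suc j ∸ i) (drop i R))) (take++drop≡id i R))

  substrs-isSubstring : ∀ C → All Substring (map (substr R) C)
  substrs-isSubstring [] = []
  substrs-isSubstring (b ∷ C) = substr-isSubstring b ∷ substrs-isSubstring C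

  ConsecMaximal⇒Linked : ∀ C → ConsecMaximal R C → Linked Apart (map (substr R) C)
  ConsecMaximal⇒Linked [] _ = []
  ConsecMaximal⇒Linked (b ∷ []) _ = [-]
  ConsecMaximal⇒Linked (b ∷ b′ ∷ C) (apart , maximal) = apart ∷ ConsecMaximal⇒Linked (b′ ∷ C) maximal

substr-≢[] : ∀ {A : Set} (R : List A) {b} → ValidBlock R b → substr R b ≢ []
substr-≢[] (_ ∷ R) {zero , j} _ ()
substr-≢[] (_ ∷ R) {suc i , suc j} (s≤s i≤j , s≤s j<|R|) = substr-≢[] R (i≤j , j<|R|)

cover-of-[] : ∀ {A : Set} {R : List A} {C} → IsCover R [] C → C ≡ []
cover-of-[] {C = []} _ = refl
cover-of-[] {R = R} {C = b ∷ C} (valid ∷ _ , covers) =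
  contradiction (++-conicalˡ (substr R b) _ covers) (substr-≢[] R valid)

lemma1 : {A : Set} (R S : List A) (Cmax C : List Block) →
         IsMaximalCover R S Cmax → IsCover R S C →
         length Cmax ≤ 2 * length C ∸ 1
lemma1 R S Cmax [] (Cmax-covers , _) (_ , refl) = ≤-reflexive (cong length (cover-of-[] Cmax-covers))
lemma1 R S Cmax (c ∷ C) ((_ , Cmax-covers) , maximal) (_ , C-covers) =
  subst₂ _≤_ (length-map (substr R) Cmax) bound
    (length-linked≤1+2*length R (map (substr R) Cmax) (substr R c) (map (substr R) C)
      (ConsecMaximal⇒Linked R Cmax maximal) (substr-isSubstring R c) (substrs-isSubstring R C)
      (trans Cmax-covers (sym C-covers)))
  where
  bound : suc (2 * length (map (substr R) C)) ≡ 2 * length (c ∷ C) ∸ 1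
  bound = trans (cong (λ n → suc (2 * n)) (length-map (substr R) C)) (sym (2*[1+n]∸1≡1+2*n (length C)))
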